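{- Let $G$ be a graph, let $s,t\in V(G)$ be distinct, and let $k,l$ be non-negative integers. Then $(k,l)$ is a connectivity pair for $s$ and $t$ in $G$ if and only if $(k,l-|E(s,t)|)$ is a connectivity pair for $s$ and $t$ in $G-E(s,t)$.
   Context: Graphs are finite and may contain parallel edges but no loops; $E(s,t)$ is the set of edges joining $s$ and $t$. For distinct $s,t$, an $s$-$t$ disconnecting pair is a pair $(W,F)$ with $W\subseteq V(G)\setminus\{s,t\}$, $F\subseteq E(G)$, such that $s$ and $t$ are not connected in $G-W-F$; its order is $|W|$, its size $|F|$, its cardinality $|W|+|F|$. An ordered pair $(k,l)$ of non-negative integers is a connectivity pair for $s$ and $t$ if there exists an $s$-$t$ disconnecting pair of order $k$ and size $l$, and there is no $s$-$t$ disconnecting pair of cardinality less than $k+l$ with order at most $k$ and size at most $l$. -}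

module Defs where

open import Data.Nat using (ℕ; _+_; _≤_; _<_)
open import Data.Fin using (Fin; _≟_)
open import Data.Fin.Subset using (Subset; _∈_; _∉_; ∣_∣)
open import Data.Product using (_×_; _,_; proj₁; proj₂; Σ; ∃)
open import Data.Sum using (_⊎_)
open import Data.List using (List; length; lookup; filter)
open import Data.List.Relation.Unary.All using (All)
open import Data.List.Relation.Unary.All.Properties using (filter⁺)
open import Relation.Nullary using (¬_; Dec)
open import Relation.Nullary.Decidable using (_×-dec_; _⊎-dec_)
open import Relation.Binary.PropositionalEquality using (_≡_; _≢_)

-- A finite multigraph on vertex set Fin n: a list of edges (each given by
-- its two endpoints); parallel edges are allowed, loops are not.
record Graph (n : ℕ) : Set where
  constructor graph
  field
    edges    : List (Fin n × Fin n)
    loopless : All (λ e → proj₁ e ≢ proj₂ e) edges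
open Graph public

Edge : ∀ {n} → Graph n → Set
Edge G = Fin (length (edges G))

Joins : ∀ {n} → Fin n → Fin n → Fin n × Fin n → Set
Joins u v e = (proj₁ e ≡ u × proj₂ e ≡ v) ⊎ (proj₁ e ≡ v × proj₂ e ≡ u)

joins? : ∀ {n} (u v : Fin n) (e : Fin n × Fin n) → Dec (Joins u v e)
joins? u v e = ((proj₁ e ≟ u) ×-dec (proj₂ e ≟ v)) ⊎-dec ((proj₁ e ≟ v) ×-dec (proj₂ e ≟ u))

NotJoins : ∀ {n} → Fin n → Fin n → Fin n × Fin n → Set
NotJoins u v e = ¬ Joins u v e

notJoins? : ∀ {n} (u v : Fin n) (e : Fin n × Fin n) → Dec (NotJoins u v e)
notJoins? u v e = Relation.Nullary.¬? (joins? u v e)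

deleteBetween : ∀ {n} → Graph n → Fin n → Fin n → Graph n
deleteBetween G s t =
  graph (filter (notJoins? s t) (edges G)) (filter⁺ (notJoins? s t) (loopless G))

numBetween : ∀ {n} → Graph n → Fin n → Fin n → ℕ
numBetween G s t = length (filter (joins? s t) (edges G))

-- Reach G W F s v : there is a walk from s to v in G - W - F
-- (all vertices of the walk after s avoid W, all its edges avoid F).
data Reach {n} (G : Graph n) (W : Subset n) (F : Subset (length (edges G)))
           (s : Fin n) : Fin n → Set where
  here : Reach G W F s s
  step : ∀ {u v} (i : Edge G) → Reach G W F s u → i ∉ F → v ∉ W →
         Joins u v (lookup (edges G) i) → Reach G W F s v

IsDisconnecting : ∀ {n} (G : Graph n) (s t : Fin n) →
                  Subset n → Subset (length (edges G)) → Set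
IsDisconnecting G s t W F = s ∉ W × t ∉ W × ¬ Reach G W F s t

IsConnectivityPair : ∀ {n} (G : Graph n) (s t : Fin n) (k l : ℕ) → Set
IsConnectivityPair G s t k l =
  (Σ (Subset _) λ W → Σ (Subset (length (edges G))) λ F →
      IsDisconnecting G s t W F × ∣ W ∣ ≡ k × ∣ F ∣ ≡ l)
  × ¬ (Σ (Subset _) λ W → Σ (Subset (length (edges G))) λ F →
      IsDisconnecting G s t W F × ∣ W ∣ ≤ k × ∣ F ∣ ≤ l × ∣ W ∣ + ∣ F ∣ < k + l)

module Submission where

-- Write G' = G - E(s,t) and m = |E(s,t)|.  The edges of G' are the edges of G
-- not joining s and t, so an edge set F' of G' lifts to the edge set
-- extend F' = F' ∪ E(s,t) of G (of size |F'| + m), and an edge set F of G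
-- restricts to restrict F = F ∖ E(s,t), viewed in G'.  Two facts drive the proof:
--   * a walk in G avoiding extend F' is a walk in G' avoiding F', and a walk
--     in G' avoiding restrict F is a walk in G avoiding F; hence both maps
--     send s-t disconnecting pairs (W , F) to disconnecting pairs (W , _);
--   * every s-t disconnecting pair of G contains all of E(s,t) (otherwise an
--     s-t edge is itself a walk), so restrict F has exactly |F| - m edges.
-- Consequently "(W,F) realises (k,l)" and "(W,F) beats (k,l)" transfer back and
-- forth between G and G' with l replaced by l - m, which is the theorem.

open import Defs
open import Data.Nat using (ℕ; suc; _+_; _≤_; _<_; _∸_)
open import Data.Nat.Properties
  using (+-assoc; +-suc; m≤n+m; m+n∸n≡m; m∸n+n≡m; m+n≤o⇒m≤o∸n; m≤o∸n⇒m+n≤o;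
         +-monoˡ-<; +-cancelʳ-<)
open import Data.Fin using (Fin; zero; suc)
open import Data.Fin.Subset using (Subset; inside; outside; _∈_; ∣_∣)
open import Data.Fin.Subset.Properties using (_∈?_; drop-there)
open import Data.Vec using (_∷_; []; here; there)
open import Data.List using (_∷_; []; length; filter; lookup)
open import Data.Product using (Σ; ∃; _×_; _,_; map; map₂)
open import Data.Empty using (⊥-elim)
open import Relation.Nullary using (Dec; yes; no; ¬_; ¬?)
open import Relation.Unary using (Decidable)
open import Relation.Binary.PropositionalEquality
  using (_≡_; _≢_; refl; sym; trans; cong; subst; subst₂)
open import Function.Bundles using (_⇔_; mk⇔; module Equivalence)

module FilterIndices {A : Set} {Q : A → Set} (Q? : Decidable Q) where

  kept? : (x : A) → Dec (¬ Q x)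
  kept? x = ¬? (Q? x)

  embed : ∀ xs → Fin (length (filter kept? xs)) → Fin (length xs)
  embed (x ∷ xs) j with Q? x
  ... | yes _ = suc (embed xs j)
  embed (x ∷ xs) zero    | no _ = zero
  embed (x ∷ xs) (suc j) | no _ = suc (embed xs j)

  lookup-embed : ∀ xs j → lookup (filter kept? xs) j ≡ lookup xs (embed xs j)
  lookup-embed (x ∷ xs) j with Q? x
  ... | yes _ = lookup-embed xs j
  lookup-embed (x ∷ xs) zero    | no _ = refl
  lookup-embed (x ∷ xs) (suc j) | no _ = lookup-embed xs j

  embed-onto : ∀ xs i → ¬ Q (lookup xs i) → ∃ λ j → embed xs j ≡ i
  embed-onto (x ∷ xs) i ¬q with Q? x
  embed-onto (x ∷ xs) zero    ¬q | yes q = ⊥-elim (¬q q)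
  embed-onto (x ∷ xs) (suc i) ¬q | yes _ = map₂ (cong suc) (embed-onto xs i ¬q)
  embed-onto (x ∷ xs) zero    ¬q | no _  = zero , refl
  embed-onto (x ∷ xs) (suc i) ¬q | no _  = map suc (cong suc) (embed-onto xs i ¬q)

  restrict : ∀ xs → Subset (length xs) → Subset (length (filter kept? xs))
  restrict []       []      = []
  restrict (x ∷ xs) (b ∷ F) with Q? x
  ... | yes _ = restrict xs F
  ... | no _  = b ∷ restrict xs F

  ∈-restrict : ∀ xs F j → embed xs j ∈ F → j ∈ restrict xs F
  ∈-restrict (x ∷ xs) (b ∷ F) j e∈ with Q? x
  ... | yes _ = ∈-restrict xs F j (drop-there e∈)
  ∈-restrict (x ∷ xs) (b ∷ F) zero    here       | no _ = here
  ∈-restrict (x ∷ xs) (b ∷ F) (suc j) (there e∈) | no _ = there (∈-restrict xs F j e∈)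

  card-restrict : ∀ xs F → (∀ i → Q (lookup xs i) → i ∈ F) →
                  ∣ restrict xs F ∣ + length (filter Q? xs) ≡ ∣ F ∣
  card-restrict []       []      covers = refl
  card-restrict (x ∷ xs) (b ∷ F) covers with Q? x | covers zero
  ... | yes q | covers₀ with covers₀ q
  ... | here = trans (+-suc _ _) (cong suc (card-restrict xs F (λ i q → drop-there (covers (suc i) q))))
  card-restrict (x ∷ xs) (inside ∷ F)  covers | no _ | _ =
    cong suc (card-restrict xs F (λ i q → drop-there (covers (suc i) q)))
  card-restrict (x ∷ xs) (outside ∷ F) covers | no _ | _ =
    card-restrict xs F (λ i q → drop-there (covers (suc i) q))

  extend : ∀ xs → Subset (length (filter kept? xs)) → Subset (length xs)
  extend []       F' = []
  extend (x ∷ xs) F' with Q? x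
  ... | yes _ = inside ∷ extend xs F'
  extend (x ∷ xs) (b ∷ F') | no _ = b ∷ extend xs F'

  ∈-extend-removed : ∀ xs F' i → Q (lookup xs i) → i ∈ extend xs F'
  ∈-extend-removed (x ∷ xs) F' i q with Q? x
  ∈-extend-removed (x ∷ xs) F'       zero    q | yes _  = here
  ∈-extend-removed (x ∷ xs) F'       (suc i) q | yes _  = there (∈-extend-removed xs F' i q)
  ∈-extend-removed (x ∷ xs) F'       zero    q | no ¬q = ⊥-elim (¬q q)
  ∈-extend-removed (x ∷ xs) (b ∷ F') (suc i) q | no _  = there (∈-extend-removed xs F' i q)

  ∈-extend-embed : ∀ xs F' j → j ∈ F' → embed xs j ∈ extend xs F'
  ∈-extend-embed (x ∷ xs) F' j j∈ with Q? x
  ... | yes _ = there (∈-extend-embed xs F' j j∈)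
  ∈-extend-embed (x ∷ xs) (b ∷ F') zero    here       | no _ = here
  ∈-extend-embed (x ∷ xs) (b ∷ F') (suc j) (there j∈) | no _ = there (∈-extend-embed xs F' j j∈)

  card-extend : ∀ xs F' → ∣ extend xs F' ∣ ≡ ∣ F' ∣ + length (filter Q? xs)
  card-extend []       []      = refl
  card-extend (x ∷ xs) F' with Q? x
  ... | yes _ = trans (cong suc (card-extend xs F')) (sym (+-suc ∣ F' ∣ _))
  card-extend (x ∷ xs) (inside ∷ F')  | no _ = cong suc (card-extend xs F')
  card-extend (x ∷ xs) (outside ∷ F') | no _ = card-extend xs F'

cardinality-shift : ∀ {m l} w f k → m ≤ l →
                    w + (f + m) < k + l ⇔ w + f < k + (l ∸ m)
cardinality-shift {m} {l} w f k m≤l = mk⇔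
  (λ lt → +-cancelʳ-< m (w + f) (k + (l ∸ m)) (subst₂ _<_ lhs rhs lt))
  (λ lt → subst₂ _<_ (sym lhs) (sym rhs) (+-monoˡ-< m lt))
  where
  lhs : w + (f + m) ≡ w + f + m
  lhs = sym (+-assoc w f m)
  rhs : k + l ≡ k + (l ∸ m) + m
  rhs = trans (cong (k +_) (sym (m∸n+n≡m m≤l))) (sym (+-assoc k (l ∸ m) m))

module Deletion {n} (G : Graph n) (s t : Fin n) where
  open FilterIndices (joins? s t)

  G' : Graph n
  G' = deleteBetween G s t

  m : ℕ
  m = numBetween G s t

  Realises : (H : Graph n) → ℕ → ℕ → Set
  Realises H k l = Σ (Subset n) λ W → Σ (Subset (length (edges H))) λ F →
    IsDisconnecting H s t W F × ∣ W ∣ ≡ k × ∣ F ∣ ≡ l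

  Beats : (H : Graph n) → ℕ → ℕ → Set
  Beats H k l = Σ (Subset n) λ W → Σ (Subset (length (edges H))) λ F →
    IsDisconnecting H s t W F × ∣ W ∣ ≤ k × ∣ F ∣ ≤ l × ∣ W ∣ + ∣ F ∣ < k + l

  walk-delete : ∀ {W F' v} → Reach G W (extend (edges G) F') s v → Reach G' W F' s v
  walk-delete here = here
  walk-delete {F' = F'} (step i r i∉ v∉ joins) with joins? s t (lookup (edges G) i)
  ... | yes q  = ⊥-elim (i∉ (∈-extend-removed (edges G) F' i q))
  ... | no ¬q with embed-onto (edges G) i ¬q
  ... | j , refl = step j (walk-delete r) (λ j∈ → i∉ (∈-extend-embed (edges G) F' j j∈)) v∉
                     (subst (Joins _ _) (sym (lookup-embed (edges G) j)) joins)

  walk-restore : ∀ {W F v} → Reach G' W (restrict (edges G) F) s v → Reach G W F s v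
  walk-restore here = here
  walk-restore {F = F} (step j r j∉ v∉ joins) =
    step (embed (edges G) j) (walk-restore r) (λ e∈ → j∉ (∈-restrict (edges G) F j e∈)) v∉
      (subst (Joins _ _) (lookup-embed (edges G) j) joins)

  disconnecting-covers : ∀ {W F} → IsDisconnecting G s t W F →
                         ∀ i → Joins s t (lookup (edges G) i) → i ∈ F
  disconnecting-covers {F = F} (_ , t∉W , ¬reach) i joins with i ∈? F
  ... | yes i∈ = i∈
  ... | no i∉  = ⊥-elim (¬reach (step i here i∉ t∉W joins))

  extend-disconnecting : ∀ {W F'} → IsDisconnecting G' s t W F' →
                         IsDisconnecting G s t W (extend (edges G) F')
  extend-disconnecting (s∉W , t∉W , ¬reach) = s∉W , t∉W , λ r → ¬reach (walk-delete r)

  restrict-disconnecting : ∀ {W F} → IsDisconnecting G s t W F →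
                           IsDisconnecting G' s t W (restrict (edges G) F)
  restrict-disconnecting (s∉W , t∉W , ¬reach) = s∉W , t∉W , λ r → ¬reach (walk-restore r)

  card-restrict-disconnecting : ∀ {W F} → IsDisconnecting G s t W F →
                                ∣ restrict (edges G) F ∣ + m ≡ ∣ F ∣
  card-restrict-disconnecting {F = F} d = card-restrict (edges G) F (disconnecting-covers d)

  realises-restrict : ∀ {k l} → Realises G k l → m ≤ l × Realises G' k (l ∸ m)
  realises-restrict {l = l} (W , F , d , ∣W∣ , ∣F∣) =
    subst (m ≤_) size (m≤n+m m _) ,
    (W , restrict (edges G) F , restrict-disconnecting d , ∣W∣ ,
     trans (sym (m+n∸n≡m _ m)) (cong (_∸ m) size))
    where
    size : ∣ restrict (edges G) F ∣ + m ≡ l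
    size = trans (card-restrict-disconnecting d) ∣F∣

  realises-extend : ∀ {k l} → m ≤ l → Realises G' k (l ∸ m) → Realises G k l
  realises-extend m≤l (W , F' , d , ∣W∣ , ∣F'∣) =
    W , extend (edges G) F' , extend-disconnecting d , ∣W∣ ,
    trans (card-extend (edges G) F') (trans (cong (_+ m) ∣F'∣) (m∸n+n≡m m≤l))

  beats-restrict : ∀ {k l} → m ≤ l → Beats G k l → Beats G' k (l ∸ m)
  beats-restrict {k} m≤l (W , F , d , ∣W∣≤ , ∣F∣≤ , card<) =
    W , restrict (edges G) F , restrict-disconnecting d , ∣W∣≤ ,
    m+n≤o⇒m≤o∸n _ (subst (_≤ _) (sym size) ∣F∣≤) ,
    Equivalence.to (cardinality-shift ∣ W ∣ _ k m≤l)
      (subst (λ c → ∣ W ∣ + c < _) (sym size) card<)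
    where
    size : ∣ restrict (edges G) F ∣ + m ≡ ∣ F ∣
    size = card-restrict-disconnecting d

  beats-extend : ∀ {k l} → m ≤ l → Beats G' k (l ∸ m) → Beats G k l
  beats-extend {k} m≤l (W , F' , d , ∣W∣≤ , ∣F'∣≤ , card<) =
    W , extend (edges G) F' , extend-disconnecting d , ∣W∣≤ ,
    subst (_≤ _) (sym size) (m≤o∸n⇒m+n≤o _ m≤l ∣F'∣≤) ,
    subst (λ c → ∣ W ∣ + c < _) (sym size)
      (Equivalence.from (cardinality-shift ∣ W ∣ _ k m≤l) card<)
    where
    size : ∣ extend (edges G) F' ∣ ≡ ∣ F' ∣ + m
    size = card-extend (edges G) F'

mainTheorem8 : ∀ {n} (G : Graph n) (s t : Fin n) → s ≢ t → (k l : ℕ) →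
    IsConnectivityPair G s t k l ⇔
      (numBetween G s t ≤ l × IsConnectivityPair (deleteBetween G s t) s t k (l ∸ numBetween G s t))
mainTheorem8 G s t _ k l = mk⇔ toDeleted fromDeleted
  where
  open Deletion G s t

  toDeleted : IsConnectivityPair G s t k l → m ≤ l × IsConnectivityPair G' s t k (l ∸ m)
  toDeleted (realised , unbeaten) with realises-restrict realised
  ... | m≤l , realised' = m≤l , realised' , λ beaten' → unbeaten (beats-extend m≤l beaten')

  fromDeleted : m ≤ l × IsConnectivityPair G' s t k (l ∸ m) → IsConnectivityPair G s t k l
  fromDeleted (m≤l , realised' , unbeaten') =
    realises-extend m≤l realised' , λ beaten → unbeaten' (beats-restrict m≤l beaten)
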